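{- Let $G$ be a connected graph of order $r\ge 2$. Let $H$ be a connected graph of order $t\ge 2$ and let $v$ be a vertex of $H$ of degree $t-1$. Then $\dim_s(G\circ_v H)=r(t-1)-\varpi(H-v)$.
   Context: All graphs are finite and simple; $d$ denotes shortest-path distance. A vertex $w$ strongly resolves $u,x$ if $d(w,u)=d(w,x)+d(x,u)$ or $d(w,x)=d(w,u)+d(u,x)$. A strong metric generator of a connected graph $X$ is a set of vertices $S$ such that every pair of vertices is strongly resolved by some vertex of $S$; $\dim_s(X)$ is the minimum cardinality of such a set. Rooted product: for a graph $G$ with $V(G)=\{u_1,\dots,u_n\}$ and a graph $H$ with root $v$, $G\circ_v H$ has vertex set $V(G)\times V(H)$ and edge set $\bigcup_{i=1}^n\{(u_i,b)(u_i,y): by\in E(H)\}\cup\{(u_i,v)(u_j,v): u_iu_j\in E(G)\}$. $H-v$ is the graph obtained from $H$ by deleting $v$. Two distinct vertices $x,y$ are true twins if $N[x]=N[y]$ (closed neighbourhoods). A twin-free clique of a graph $F$ is a set $X\subseteq V(F)$ inducing a complete graph and containing no two true twins of $F$ (i.e., $N_F[u]\ne N_F[w]$ for distinct $u,w\in X$); the twin-free clique number $\varpi(F)$ is the maximum cardinality of a twin-free clique in $F$. -}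

module Defs where

open import Data.Nat using (ℕ; zero; suc; _+_; _*_; _∸_; _≤_; _<_)
open import Data.Fin using (Fin; remQuot; punchIn)
open import Data.Fin.Properties using (_≟_)
open import Data.Fin.Subset using (Subset; _∈_; ∣_∣)
open import Data.Bool using (Bool; true; false; _∧_; _∨_)
open import Data.Bool.Properties using (∧-comm)
open import Data.Product using (Σ; ∃; _×_; _,_)
open import Data.Sum using (_⊎_)
open import Relation.Nullary using (¬_; yes; no)
open import Relation.Nullary.Decidable using (⌊_⌋)
open import Relation.Binary.PropositionalEquality
  using (_≡_; _≢_; refl; sym; cong₂)

record Graph (n : ℕ) : Set where
  field
    adj    : Fin n → Fin n → Bool
    sym'   : ∀ x y → adj x y ≡ adj y x
    irrefl : ∀ x → adj x x ≡ false
open Graph public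

Adj : ∀ {n} → Graph n → Fin n → Fin n → Set
Adj G x y = adj G x y ≡ true

data Walk {n} (G : Graph n) : Fin n → Fin n → ℕ → Set where
  here : ∀ {x} → Walk G x x 0
  step : ∀ {x y z k} → Adj G x y → Walk G y z k → Walk G x z (suc k)

Dist : ∀ {n} → Graph n → Fin n → Fin n → ℕ → Set
Dist G x y k = Walk G x y k × (∀ m → m < k → ¬ Walk G x y m)

Connected : ∀ {n} → Graph n → Set
Connected G = ∀ x y → ∃ λ k → Walk G x y k

nbhd : ∀ {n} → Graph n → Fin n → Subset n
nbhd {zero}  G x = Data.Vec.[]  where import Data.Vec
nbhd {suc n} G x = Data.Vec.tabulate (adj G x) where import Data.Vec

degree : ∀ {n} → Graph n → Fin n → ℕ
degree G x = ∣ nbhd G x ∣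

StronglyResolves : ∀ {n} → Graph n → Fin n → Fin n → Fin n → Set
StronglyResolves G w u x =
  (Σ ℕ λ a → Σ ℕ λ b → Σ ℕ λ c →
     Dist G w u a × Dist G w x b × Dist G x u c × a ≡ b + c)
  ⊎
  (Σ ℕ λ a → Σ ℕ λ b → Σ ℕ λ c →
     Dist G w x a × Dist G w u b × Dist G u x c × a ≡ b + c)

StrongMetricGenerator : ∀ {n} → Graph n → Subset n → Set
StrongMetricGenerator G S =
  ∀ u x → u ≢ x → ∃ λ w → w ∈ S × StronglyResolves G w u x

IsStrongMetricDim : ∀ {n} → Graph n → ℕ → Set
IsStrongMetricDim G k =
  (∃ λ S → StrongMetricGenerator G S × ∣ S ∣ ≡ k)
  × (∀ S → StrongMetricGenerator G S → k ≤ ∣ S ∣)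

TrueTwins : ∀ {n} → Graph n → Fin n → Fin n → Set
TrueTwins G x y =
  ∀ z → ((z ≡ x ⊎ Adj G x z) → (z ≡ y ⊎ Adj G y z))
      × ((z ≡ y ⊎ Adj G y z) → (z ≡ x ⊎ Adj G x z))

TwinFreeClique : ∀ {n} → Graph n → Subset n → Set
TwinFreeClique G X =
  (∀ u w → u ∈ X → w ∈ X → u ≢ w → Adj G u w)
  × (∀ u w → u ∈ X → w ∈ X → u ≢ w → ¬ TrueTwins G u w)

IsTwinFreeCliqueNumber : ∀ {n} → Graph n → ℕ → Set
IsTwinFreeCliqueNumber F k =
  (∃ λ X → TwinFreeClique F X × ∣ X ∣ ≡ k)
  × (∀ X → TwinFreeClique F X → ∣ X ∣ ≤ k)

deleteVertex : ∀ {n} → Graph (suc n) → Fin (suc n) → Graph n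
deleteVertex H v = record
  { adj    = λ x y → adj H (punchIn v x) (punchIn v y)
  ; sym'   = λ x y → sym' H (punchIn v x) (punchIn v y)
  ; irrefl = λ x → irrefl H (punchIn v x) }

eqb : ∀ {n} → Fin n → Fin n → Bool
eqb i j = ⌊ i ≟ j ⌋

eqb-sym : ∀ {n} (i j : Fin n) → eqb i j ≡ eqb j i
eqb-sym i j with i ≟ j | j ≟ i
... | yes _ | yes _ = refl
... | no  _ | no  _ = refl
... | yes p | no ¬q = Data.Empty.⊥-elim (¬q (sym p)) where import Data.Empty
... | no ¬p | yes q = Data.Empty.⊥-elim (¬p (sym q)) where import Data.Empty

eqb-refl : ∀ {n} (i : Fin n) → eqb i i ≡ true
eqb-refl i with i ≟ i
... | yes _ = refl
... | no ¬p = Data.Empty.⊥-elim (¬p refl) where import Data.Empty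

rpAdj : ∀ {r t} → Graph r → Fin t → Graph t → (Fin r × Fin t) → (Fin r × Fin t) → Bool
rpAdj G v H (i , b) (j , y) =
  (eqb i j ∧ adj H b y) ∨ ((eqb b v ∧ eqb y v) ∧ adj G i j)

rpAdj-sym : ∀ {r t} (G : Graph r) (v : Fin t) (H : Graph t) p q →
  rpAdj G v H p q ≡ rpAdj G v H q p
rpAdj-sym G v H (i , b) (j , y) =
  cong₂ _∨_ (cong₂ _∧_ (eqb-sym i j) (sym' H b y))
            (cong₂ _∧_ (∧-comm (eqb b v) (eqb y v)) (sym' G i j))

rpAdj-irr : ∀ {r t} (G : Graph r) (v : Fin t) (H : Graph t) p →
  rpAdj G v H p p ≡ false
rpAdj-irr G v H (i , b) rewrite eqb-refl i | irrefl H b | irrefl G i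
  with eqb b v
... | true  = refl
... | false = refl

-- G ∘_v H ; vertex (u_i , b) is encoded in Fin (r * t) via remQuot / combine
rootedProduct : ∀ {r t} → Graph r → Fin t → Graph t → Graph (r * t)
rootedProduct {r} {t} G v H = record
  { adj    = λ p q → rpAdj G v H (remQuot t p) (remQuot t q)
  ; sym'   = λ p q → rpAdj-sym G v H (remQuot t p) (remQuot t q)
  ; irrefl = λ p → rpAdj-irr G v H (remQuot t p) }

-- Because v is universal in H, each copy of H hangs from its root at depth at most 1: the distance
-- between (i , a) and (j , b) is d_H(a , b) ≤ 2 inside a copy and depth a + d_G(i , j) + depth b
-- across copies.  Two non-root vertices of different copies, and two non-root vertices of one copy
-- that are non-adjacent or true twins, are strongly resolved only by themselves.  Hence a strong
-- metric generator contains every non-root vertex except those of a twin-free clique of H − v inside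
-- a single copy.  Conversely, deleting a maximum twin-free clique of H − v from the non-root vertices
-- of one copy leaves a strong metric generator: two roots are resolved by a leaf hanging from one of
-- them, and two clique vertices by a neighbour of one that is not a closed neighbour of the other.

module Submission where

open import Defs
open import Data.Nat using (ℕ; zero; suc; _+_; _*_; _∸_; _≤_; _<_; z≤n; s≤s)
open import Data.Nat.Properties hiding (_≟_; suc-injective)
open import Data.Nat.Tactic.RingSolver using (solve-∀)
open import Data.Fin using (Fin; zero; suc; remQuot; combine; punchIn; punchOut; _↑ˡ_; _↑ʳ_)
open import Data.Fin.Properties
  using (_≟_; any?; ¬∀⟶∃¬; suc-injective; remQuot-combine; combine-remQuot;
         punchIn-injective; punchInᵢ≢i; punchIn-punchOut; punchOut-punchIn; punchOut-cong)
open import Data.Fin.Subset using (Subset; _∈_; _∉_; ∣_∣; _⊆_)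
open import Data.Fin.Subset.Properties using (_∈?_; p⊆q⇒∣p∣≤∣q∣)
open import Data.Vec using (tabulate; lookup)
open import Data.Vec.Properties using (tabulate∘lookup; lookup∘tabulate; lookup⇒[]=; []=⇒lookup)
open import Data.Bool using (Bool; true; false; T; not; _∧_; _∨_; if_then_else_) renaming (_≟_ to _≟ᵇ_)
open import Data.Bool.Properties using (∨-zeroʳ)
open import Data.Unit using (tt)
open import Data.Empty using (⊥-elim)
open import Data.Product using (Σ; ∃; _×_; _,_; proj₁; proj₂)
open import Data.Sum using (_⊎_; inj₁; inj₂; [_,_]′; swap)
open import Function using (_∘_)
open import Relation.Nullary using (¬_; Dec; yes; no; contradiction)
open import Relation.Nullary.Decidable
  using (toWitness; decidable-stable; ⌊_⌋; ¬?; _⊎-dec_; _×-dec_; _→-dec_)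
open import Relation.Binary.PropositionalEquality
  using (_≡_; _≢_; refl; sym; trans; cong; cong₂; subst; subst₂; module ≡-Reasoning)

module _ {n} {G : Graph n} where

  walk-++ : ∀ {x y z a b} → Walk G x y a → Walk G y z b → Walk G x z (a + b)
  walk-++ here q = q
  walk-++ (step e p) q = step e (walk-++ p q)

  walk-reverse : ∀ {x y k} → Walk G x y k → Walk G y x k
  walk-reverse here = here
  walk-reverse {x} {k = suc k} (step {y = y} e p) =
    subst (Walk G _ x) (+-comm k 1) (walk-++ (walk-reverse p) (step (trans (sym' G y x) e) here))

  walk₀⇒≡ : ∀ {x y} → Walk G x y 0 → x ≡ y
  walk₀⇒≡ here = refl

walk? : ∀ {n} (G : Graph n) k x y → Dec (Walk G x y k)
walk? G zero x y with x ≟ y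
... | yes refl = yes here
... | no x≢y = no λ { here → x≢y refl }
walk? G (suc k) x y with any? (λ z → (adj G x z ≟ᵇ true) ×-dec walk? G k z y)
... | yes (z , e , p) = yes (step e p)
... | no ∄z = no λ { (step {y = z} e p) → ∄z (z , e , p) }

Least : (ℕ → Set) → ℕ → Set
Least P m = P m × (∀ m' → m' < m → ¬ P m')

least-below : (P : ℕ → Set) → (∀ m → Dec (P m)) → ∀ n → ∃ (Least P) ⊎ (∀ m → m < n → ¬ P m)
least-below P P? zero = inj₂ λ m ()
least-below P P? (suc n) with least-below P P? n
... | inj₁ least = inj₁ least
... | inj₂ none with P? n
...   | yes pn = inj₁ (n , pn , none)
...   | no ¬pn = inj₂ λ m m<1+n → [ none m , (λ { refl → ¬pn }) ]′ (m<1+n⇒m<n∨m≡n m<1+n)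

least-witness : (P : ℕ → Set) → (∀ m → Dec (P m)) → ∀ {k} → P k → ∃ (Least P)
least-witness P P? {k} pk with least-below P P? (suc k)
... | inj₁ least = least
... | inj₂ none = contradiction pk (none k (n<1+n k))

module _ {n} {G : Graph n} {x y : Fin n} where

  -- Dist G x y is definitionally Least (Walk G x y).
  walk⇒dist : ∀ {k} → Walk G x y k → ∃ (Dist G x y)
  walk⇒dist = least-witness (λ m → Walk G x y m) (λ m → walk? G m x y)

  dist≤walk : ∀ {m k} → Dist G x y m → Walk G x y k → m ≤ k
  dist≤walk {m} {k} (_ , minimal) w with m ≤? k
  ... | yes m≤k = m≤k
  ... | no m≰k = contradiction w (minimal k (≰⇒> m≰k))

  dist-unique : ∀ {m k} → Dist G x y m → Dist G x y k → m ≡ k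
  dist-unique d d′ = ≤-antisym (dist≤walk d (proj₁ d′)) (dist≤walk d′ (proj₁ d))

module Distance {n} (G : Graph n) (connected : Connected G) where

  d : Fin n → Fin n → ℕ
  d x y = proj₁ (walk⇒dist (proj₂ (connected x y)))

  d-dist : ∀ x y → Dist G x y (d x y)
  d-dist x y = proj₂ (walk⇒dist (proj₂ (connected x y)))

  d-walk : ∀ x y → Walk G x y (d x y)
  d-walk x y = proj₁ (d-dist x y)

  d-triangle : ∀ x y z → d x z ≤ d x y + d y z
  d-triangle x y z = dist≤walk (d-dist x z) (walk-++ (d-walk x y) (d-walk y z))

  d-adj : ∀ {x y} → Adj G x y → d x y ≤ 1
  d-adj e = dist≤walk (d-dist _ _) (step e here)

  d-pos : ∀ {x y} → x ≢ y → 1 ≤ d x y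
  d-pos {x} {y} x≢y with d x y | d-walk x y
  ... | zero  | w = contradiction (walk₀⇒≡ w) x≢y
  ... | suc _ | _ = s≤s z≤n

bit : Bool → ℕ
bit true  = 1
bit false = 0

count : ∀ {n} → (Fin n → Bool) → ℕ
count {zero}  f = 0
count {suc n} f = bit (f zero) + count (f ∘ suc)

∣tabulate∣≡count : ∀ {n} (f : Fin n → Bool) → ∣ tabulate f ∣ ≡ count f
∣tabulate∣≡count {zero}  f = refl
∣tabulate∣≡count {suc n} f with f zero
... | true  = cong suc (∣tabulate∣≡count (f ∘ suc))
... | false = ∣tabulate∣≡count (f ∘ suc)

∣p∣≡count : ∀ {n} (p : Subset n) → ∣ p ∣ ≡ count (lookup p)
∣p∣≡count p = trans (cong ∣_∣ (sym (tabulate∘lookup p))) (∣tabulate∣≡count (lookup p))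

count-cong : ∀ {n} {f g : Fin n → Bool} → (∀ x → f x ≡ g x) → count f ≡ count g
count-cong {zero}  f≗g = refl
count-cong {suc n} f≗g = cong₂ _+_ (cong bit (f≗g zero)) (count-cong (f≗g ∘ suc))

count-↑ : ∀ t {m} (f : Fin (t + m) → Bool) → count f ≡ count (f ∘ (_↑ˡ m)) + count (f ∘ (t ↑ʳ_))
count-↑ zero    f = refl
count-↑ (suc t) f = trans (cong (bit (f zero) +_) (count-↑ t (f ∘ suc))) (sym (+-assoc (bit (f zero)) _ _))

∑ : ∀ r → (Fin r → ℕ) → ℕ
∑ zero    h = 0
∑ (suc r) h = h zero + ∑ r (h ∘ suc)

count-remQuot : ∀ r t (g : Fin r × Fin t → Bool) →
  count {r * t} (g ∘ remQuot t) ≡ ∑ r (λ i → count (λ b → g (i , b)))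
count-remQuot zero    t g = refl
count-remQuot (suc r) t g = begin
  count (g ∘ remQuot t)
    ≡⟨ count-↑ t (g ∘ remQuot t) ⟩
  count (g ∘ remQuot t ∘ (_↑ˡ (r * t))) + count (g ∘ remQuot {suc r} t ∘ (t ↑ʳ_))
    ≡⟨ cong₂ _+_ (count-cong (λ b → cong g (remQuot-combine {suc r} zero b)))
                 (count-cong (λ j → cong g (remQuot-↑ʳ j))) ⟩
  count (λ b → g (zero , b)) + count (g′ ∘ remQuot t)
    ≡⟨ cong (count (λ b → g (zero , b)) +_) (count-remQuot r t g′) ⟩
  ∑ (suc r) (λ i → count (λ b → g (i , b))) ∎
  where
  open ≡-Reasoning
  g′ : Fin r × Fin t → Bool
  g′ (i , b) = g (suc i , b)
  remQuot-↑ʳ : ∀ j → remQuot {suc r} t (t ↑ʳ j) ≡ (suc (proj₁ (remQuot {r} t j)) , proj₂ (remQuot {r} t j))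
  remQuot-↑ʳ j = trans (cong (λ k → remQuot {suc r} t (t ↑ʳ k)) (sym (combine-remQuot {r} t j)))
                       (remQuot-combine {suc r} (suc (proj₁ (remQuot {r} t j))) (proj₂ (remQuot {r} t j)))

count-punchIn : ∀ {n} (v : Fin (suc n)) (f : Fin (suc n) → Bool) → f v ≡ false → count f ≡ count (f ∘ punchIn v)
count-punchIn zero            f fv≡false = cong (λ b → bit b + count (f ∘ suc)) fv≡false
count-punchIn {suc n} (suc v) f fv≡false = cong (bit (f zero) +_) (count-punchIn v (f ∘ suc) fv≡false)

count-true : ∀ n → count {n} (λ _ → true) ≡ n
count-true zero    = refl
count-true (suc n) = cong suc (count-true n)

count+count-not : ∀ n (f : Fin n → Bool) → count f + count (not ∘ f) ≡ n
count+count-not zero    f = refl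
count+count-not (suc n) f with f zero
... | true  = cong suc (count+count-not n (f ∘ suc))
... | false = trans (+-suc _ _) (cong suc (count+count-not n (f ∘ suc)))

count≤n : ∀ n (f : Fin n → Bool) → count f ≤ n
count≤n zero    f = z≤n
count≤n (suc n) f with f zero
... | true  = s≤s (count≤n n (f ∘ suc))
... | false = m≤n⇒m≤1+n (count≤n n (f ∘ suc))

count<n : ∀ n (f : Fin n → Bool) x → f x ≡ false → count f < n
count<n (suc n) f zero fx≡false rewrite fx≡false = s≤s (count≤n n (f ∘ suc))
count<n (suc n) f (suc x) fx≡false with f zero
... | true  = s≤s (count<n n (f ∘ suc) x fx≡false)
... | false = m≤n⇒m≤1+n (count<n n (f ∘ suc) x fx≡false)

∑-deficient-row : ∀ r t (h : Fin r → ℕ) i₀ x →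
                  h i₀ + x ≡ t → (∀ i → i ≢ i₀ → h i ≡ t) → ∑ r h + x ≡ r * t
∑-deficient-row (suc r) t h zero x row₀ rows = begin
  h zero + ∑ r (h ∘ suc) + x   ≡⟨ +-assoc (h zero) _ x ⟩
  h zero + (∑ r (h ∘ suc) + x) ≡⟨ cong (h zero +_) (+-comm _ x) ⟩
  h zero + (x + ∑ r (h ∘ suc)) ≡⟨ sym (+-assoc (h zero) x _) ⟩
  h zero + x + ∑ r (h ∘ suc)   ≡⟨ cong₂ _+_ row₀ (∑-const r (h ∘ suc) (λ i → rows (suc i) λ ())) ⟩
  t + r * t                    ∎
  where
  open ≡-Reasoning
  ∑-const : ∀ r (h : Fin r → ℕ) → (∀ i → h i ≡ t) → ∑ r h ≡ r * t
  ∑-const zero    h _    = refl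
  ∑-const (suc r) h h≗t = cong₂ _+_ (h≗t zero) (∑-const r (h ∘ suc) (h≗t ∘ suc))
∑-deficient-row (suc r) t h (suc i₀) x row₀ rows =
  trans (+-assoc (h zero) _ x)
        (cong₂ _+_ (rows zero λ ())
                   (∑-deficient-row r t (h ∘ suc) i₀ x row₀ (λ i i≢i₀ → rows (suc i) (i≢i₀ ∘ suc-injective))))

full-degree⇒universal : ∀ {t'} (H : Graph (suc t')) v → degree H v ≡ t' → ∀ b → b ≢ v → Adj H v b
full-degree⇒universal {t'} H v deg b b≢v with adj H v b in v≁b
... | true  = refl
... | false = contradiction deg (<⇒≢ (begin-strict
  degree H v                ≡⟨ ∣tabulate∣≡count (adj H v) ⟩
  count (adj H v)           ≡⟨ count-punchIn v (adj H v) (irrefl H v) ⟩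
  count (adj H v ∘ punchIn v) <⟨ count<n t' _ (punchOut v≢b) (trans (cong (adj H v) (punchIn-punchOut v≢b)) v≁b) ⟩
  t'                        ∎))
  where
  open ≤-Reasoning
  v≢b = b≢v ∘ sym

m≢m+1+n : ∀ {m n} → m ≢ m + suc n
m≢m+1+n {m} eq = m+1+n≢m m (sym eq)

m≤2⇒m≢n+[1+o+1] : ∀ {m n o} → m ≤ 2 → 1 ≤ o → m ≢ n + (1 + o + 1)
m≤2⇒m≢n+[1+o+1] {m} {n} {o} m≤2 1≤o m≡ = <-irrefl refl (begin-strict
  m               ≤⟨ m≤2 ⟩
  2               <⟨ s≤s (+-monoˡ-≤ 1 1≤o) ⟩
  1 + o + 1       ≤⟨ m≤n+m _ n ⟩
  n + (1 + o + 1) ≡⟨ sym m≡ ⟩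
  m               ∎)
  where open ≤-Reasoning

m+o+1≡n+[1+o+1]⇒m≡1+n : ∀ {m n o} → m + o + 1 ≡ n + (1 + o + 1) → m ≡ suc n
m+o+1≡n+[1+o+1]⇒m≡1+n {m} {n} {o} eq = +-cancelʳ-≡ (o + 1) m (suc n) (begin
  m + (o + 1)     ≡⟨ sym (+-assoc m o 1) ⟩
  m + o + 1       ≡⟨ eq ⟩
  n + (1 + o + 1) ≡⟨ +-suc n (o + 1) ⟩
  suc n + (o + 1) ∎)
  where open ≡-Reasoning

module _ {n} (G : Graph n) where

  Adj-sym : ∀ {x y} → Adj G x y → Adj G y x
  Adj-sym {x} {y} x~y = trans (sym' G y x) x~y

  Adj⇒≢ : ∀ {x y} → Adj G x y → x ≢ y
  Adj⇒≢ {x} x~x refl = contradiction (trans (sym x~x) (irrefl G x)) λ ()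

eqb⇒≡ : ∀ {n} {i j : Fin n} → eqb i j ≡ true → i ≡ j
eqb⇒≡ {i = i} {j} e = toWitness {a? = i ≟ j} (subst T (sym e) tt)

≢⇒eqb≡false : ∀ {n} {i j : Fin n} → i ≢ j → eqb i j ≡ false
≢⇒eqb≡false {i = i} {j} i≢j with i ≟ j
... | yes i≡j = contradiction i≡j i≢j
... | no  _   = refl

Bool-ext : ∀ {x y} → (x ≡ true → y ≡ true) → (y ≡ true → x ≡ true) → x ≡ y
Bool-ext {true}  {true}  _ _ = refl
Bool-ext {false} {false} _ _ = refl
Bool-ext {true}  {false} x⇒y _ = sym (x⇒y refl)
Bool-ext {false} {true}  _ y⇒x = y⇒x refl

∨≡true : ∀ x {y} → x ∨ y ≡ true → x ≡ true ⊎ y ≡ true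
∨≡true true  _ = inj₁ refl
∨≡true false e = inj₂ e

∧≡true : ∀ x {y} → x ∧ y ≡ true → x ≡ true × y ≡ true
∧≡true true e = refl , e

ClosedNbr : ∀ {n} → Graph n → Fin n → Fin n → Set
ClosedNbr F x z = z ≡ x ⊎ Adj F x z

closedNbr? : ∀ {n} (F : Graph n) x z → Dec (ClosedNbr F x z)
closedNbr? F x z = (z ≟ x) ⊎-dec (adj F x z ≟ᵇ true)

distinguisher : ∀ {n} (F : Graph n) {x y} → ¬ TrueTwins F x y →
                ∃ λ z → (ClosedNbr F x z × ¬ ClosedNbr F y z) ⊎ (ClosedNbr F y z × ¬ ClosedNbr F x z)
distinguisher F {x} {y} ¬twins
  with ¬∀⟶∃¬ _ _ (λ z → (closedNbr? F x z →-dec closedNbr? F y z) ×-dec (closedNbr? F y z →-dec closedNbr? F x z))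
              ¬twins
... | z , ¬same with closedNbr? F x z | closedNbr? F y z
...   | yes xz | yes yz = ⊥-elim (¬same ((λ _ → yz) , (λ _ → xz)))
...   | yes xz | no ¬yz = z , inj₁ (xz , ¬yz)
...   | no ¬xz | yes yz = z , inj₂ (yz , ¬xz)
...   | no ¬xz | no ¬yz = ⊥-elim (¬same ((λ xz → contradiction xz ¬xz) , (λ yz → contradiction yz ¬yz)))

module UniversalVertex {t} (H : Graph t) (v : Fin t) (universal : ∀ b → b ≢ v → Adj H v b) where

  depth : Fin t → ℕ
  depth b with b ≟ v
  ... | yes _ = 0
  ... | no  _ = 1

  depth-root : depth v ≡ 0
  depth-root with v ≟ v
  ... | yes _   = refl
  ... | no v≢v = contradiction refl v≢v

  depth-leaf : ∀ {b} → b ≢ v → depth b ≡ 1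
  depth-leaf {b} b≢v with b ≟ v
  ... | yes b≡v = contradiction b≡v b≢v
  ... | no  _   = refl

  depth≤1 : ∀ b → depth b ≤ 1
  depth≤1 b with b ≟ v
  ... | yes _ = z≤n
  ... | no  _ = s≤s z≤n

  dH : Fin t → Fin t → ℕ
  dH a b with a ≟ b
  ... | yes _ = 0
  ... | no  _ = if adj H a b then 1 else 2

  data DH (a b : Fin t) : ℕ → Set where
    equal    : a ≡ b → DH a b 0
    adjacent : Adj H a b → DH a b 1
    distant  : a ≢ b → adj H a b ≡ false → DH a b 2

  dH-view : ∀ a b → DH a b (dH a b)
  dH-view a b with a ≟ b
  ... | yes a≡b = equal a≡b
  ... | no  a≢b with adj H a b in e
  ...   | true  = adjacent e
  ...   | false = distant a≢b e

  dH-refl : ∀ a → dH a a ≡ 0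
  dH-refl a with dH a a | dH-view a a
  ... | _ | equal _      = refl
  ... | _ | adjacent a~a = contradiction refl (Adj⇒≢ H a~a)
  ... | _ | distant a≢a _ = contradiction refl a≢a

  dH-adj : ∀ {a b} → Adj H a b → dH a b ≡ 1
  dH-adj {a} {b} a~b with dH a b | dH-view a b
  ... | _ | equal a≡b     = contradiction a≡b (Adj⇒≢ H a~b)
  ... | _ | adjacent _    = refl
  ... | _ | distant _ a≁b = contradiction (trans (sym a~b) a≁b) λ ()

  dH-nonadj : ∀ {a b} → a ≢ b → adj H a b ≡ false → dH a b ≡ 2
  dH-nonadj {a} {b} a≢b a≁b with dH a b | dH-view a b
  ... | _ | equal a≡b   = contradiction a≡b a≢b
  ... | _ | adjacent a~b = contradiction (trans (sym a~b) a≁b) λ ()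
  ... | _ | distant _ _ = refl

  dH≤2 : ∀ a b → dH a b ≤ 2
  dH≤2 a b with dH a b | dH-view a b
  ... | _ | equal _     = z≤n
  ... | _ | adjacent _  = s≤s z≤n
  ... | _ | distant _ _ = ≤-refl

  dH≡0⇒≡ : ∀ {a b} → dH a b ≡ 0 → a ≡ b
  dH≡0⇒≡ {a} {b} d≡0 with dH a b | dH-view a b
  ... | _ | equal a≡b = a≡b

  dH-root : ∀ b → dH v b ≡ depth b
  dH-root b with b ≟ v
  ... | yes refl = dH-refl v
  ... | no b≢v   = dH-adj (universal b b≢v)

  dH-to-root : ∀ a → dH a v ≡ depth a
  dH-to-root a with dH a v | dH-view a v
  ... | _ | equal refl      = sym depth-root
  ... | _ | adjacent a~v    = sym (depth-leaf (Adj⇒≢ H a~v))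
  ... | _ | distant a≢v a≁v = contradiction (trans (sym (Adj-sym H (universal a a≢v))) a≁v) λ ()

  dH-twins : ∀ {e a b} → e ≢ a → e ≢ b → adj H e a ≡ adj H e b → dH e a ≡ dH e b
  dH-twins {e} {a} {b} e≢a e≢b same with dH e a | dH-view e a | dH e b | dH-view e b
  ... | _ | equal e≡a   | _ | _           = contradiction e≡a e≢a
  ... | _ | _           | _ | equal e≡b   = contradiction e≡b e≢b
  ... | _ | adjacent _  | _ | adjacent _  = refl
  ... | _ | distant _ _ | _ | distant _ _ = refl
  ... | _ | adjacent e~a | _ | distant _ e≁b = contradiction (trans (sym e~a) (trans same e≁b)) λ ()
  ... | _ | distant _ e≁a | _ | adjacent e~b = contradiction (trans (sym e~b) (trans (sym same) e≁a)) λ ()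

module RootedProduct {r t'} (G : Graph r) (H : Graph (suc t')) (v : Fin (suc t'))
  (connected : Connected G) (universal : ∀ b → b ≢ v → Adj H v b) where

  open Distance G connected renaming (d to dG)
  open UniversalVertex H v universal

  t : ℕ
  t = suc t'

  X : Graph (r * t)
  X = rootedProduct G v H

  P : Set
  P = Fin r × Fin t

  enc : P → Fin (r * t)
  enc (i , a) = combine i a

  dec : Fin (r * t) → P
  dec = remQuot t

  dec-enc : ∀ p → dec (enc p) ≡ p
  dec-enc (i , a) = remQuot-combine i a

  enc-dec : ∀ x → enc (dec x) ≡ x
  enc-dec = combine-remQuot {r} t

  enc-injective : ∀ {p q} → enc p ≡ enc q → p ≡ q
  enc-injective {p} {q} e = trans (sym (dec-enc p)) (trans (cong dec e) (dec-enc q))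

  rpAdj-cases : ∀ {i a j b} → rpAdj G v H (i , a) (j , b) ≡ true →
                (i ≡ j × Adj H a b) ⊎ (a ≡ v × b ≡ v × Adj G i j)
  rpAdj-cases {i} {a} {j} {b} e with ∨≡true (eqb i j ∧ adj H a b) e
  ... | inj₁ same-copy = let i≡j , a~b = ∧≡true (eqb i j) same-copy in inj₁ (eqb⇒≡ i≡j , a~b)
  ... | inj₂ root-edge = let roots , i~j = ∧≡true (eqb a v ∧ eqb b v) root-edge
                             a≡v , b≡v = ∧≡true (eqb a v) roots
                         in inj₂ (eqb⇒≡ a≡v , eqb⇒≡ b≡v , i~j)

  Adj-enc : ∀ {p q} → rpAdj G v H p q ≡ true → Adj X (enc p) (enc q)
  Adj-enc {p} {q} = subst₂ (λ x y → rpAdj G v H x y ≡ true) (sym (dec-enc p)) (sym (dec-enc q))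

  copy-edge : ∀ {i a b} → Adj H a b → Adj X (enc (i , a)) (enc (i , b))
  copy-edge {i} a~b = Adj-enc (cong (_∨ _) (cong₂ _∧_ (eqb-refl i) a~b))

  root-edge : ∀ {i j} → Adj G i j → Adj X (enc (i , v)) (enc (j , v))
  root-edge {i} i~j = Adj-enc (trans (cong (_ ∨_) (cong₂ _∧_ (cong₂ _∧_ (eqb-refl v) (eqb-refl v)) i~j)) (∨-zeroʳ _))

  δ : P → P → ℕ
  δ (i , a) (j , b) with i ≟ j
  ... | yes _ = dH a b
  ... | no  _ = depth a + dG i j + depth b

  δ-same : ∀ i a b → δ (i , a) (i , b) ≡ dH a b
  δ-same i a b with i ≟ i
  ... | yes _   = refl
  ... | no i≢i = contradiction refl i≢i

  δ-diff : ∀ {i j} a b → i ≢ j → δ (i , a) (j , b) ≡ depth a + dG i j + depth b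
  δ-diff {i} {j} a b i≢j with i ≟ j
  ... | yes i≡j = contradiction i≡j i≢j
  ... | no  _   = refl

  δ-refl : ∀ p → δ p p ≡ 0
  δ-refl (i , a) = trans (δ-same i a a) (dH-refl a)

  -- δ changes by at most one along an edge of X, so no walk is shorter than δ.
  δ-step : ∀ p p′ q → rpAdj G v H p p′ ≡ true → δ p q ≤ suc (δ p′ q)
  δ-step (i , a) (i′ , a′) (j , b) e with rpAdj-cases {i} {a} {i′} {a′} e
  ... | inj₁ (refl , a~a′) = inside (i ≟ j)
    where
    inside : Dec (i ≡ j) → δ (i , a) (j , b) ≤ suc (δ (i , a′) (j , b))
    inside (yes refl) rewrite δ-same i a b | δ-same i a′ b with dH a′ b | dH-view a′ b
    ... | _ | equal refl  = ≤-trans (≤-reflexive (dH-adj a~a′)) (s≤s z≤n)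
    ... | _ | adjacent _  = dH≤2 a b
    ... | _ | distant _ _ = m≤n⇒m≤1+n (dH≤2 a b)
    inside (no i≢j) rewrite δ-diff a b i≢j | δ-diff a′ b i≢j =
      +-monoˡ-≤ (depth b) (+-monoˡ-≤ (dG i j) (≤-trans (depth≤1 a) (s≤s z≤n)))
  ... | inj₂ (refl , refl , i~i′) = across (j ≟ i) (j ≟ i′)
    where
    across : Dec (j ≡ i) → Dec (j ≡ i′) → δ (i , v) (j , b) ≤ suc (δ (i′ , v) (j , b))
    across (yes refl) _ rewrite δ-same j v b | dH-root b = ≤-trans (depth≤1 b) (s≤s z≤n)
    across (no j≢i) (yes refl) rewrite δ-diff v b (j≢i ∘ sym) | δ-same j v b | dH-root b | depth-root =
      +-monoˡ-≤ (depth b) (d-adj i~i′)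
    across (no j≢i) (no j≢i′) rewrite δ-diff v b (j≢i ∘ sym) | δ-diff v b (j≢i′ ∘ sym) | depth-root =
      +-monoˡ-≤ (depth b) (≤-trans (d-triangle i i′ j) (+-monoˡ-≤ (dG i′ j) (d-adj i~i′)))

  walk-lower : ∀ {x y k} → Walk X x y k → δ (dec x) (dec y) ≤ k
  walk-lower {x} here = ≤-reflexive (δ-refl (dec x))
  walk-lower {x} {z} (step {y = y} e w) = ≤-trans (δ-step (dec x) (dec y) (dec z) e) (s≤s (walk-lower w))

  root-walk : ∀ {i j k} → Walk G i j k → Walk X (enc (i , v)) (enc (j , v)) k
  root-walk here       = here
  root-walk (step e w) = step (root-edge e) (root-walk w)

  climb : ∀ i a → Walk X (enc (i , a)) (enc (i , v)) (depth a)
  climb i a with a ≟ v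
  ... | yes refl = here
  ... | no a≢v   = step (copy-edge (Adj-sym H (universal a a≢v))) here

  copy-walk : ∀ i a b → Walk X (enc (i , a)) (enc (i , b)) (dH a b)
  copy-walk i a b with dH a b | dH-view a b
  ... | _ | equal refl      = here
  ... | _ | adjacent a~b    = step (copy-edge a~b) here
  ... | _ | distant a≢b a≁b =
    step (copy-edge (Adj-sym H (universal a a≢v))) (step (copy-edge (universal b b≢v)) here)
    where
    a≢v : a ≢ v
    a≢v refl = contradiction (trans (sym (universal b (a≢b ∘ sym))) a≁b) λ ()
    b≢v : b ≢ v
    b≢v refl = contradiction (trans (sym (Adj-sym H (universal a a≢b))) a≁b) λ ()

  walk-upper : ∀ p q → Walk X (enc p) (enc q) (δ p q)
  walk-upper (i , a) (j , b) with i ≟ j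
  ... | yes refl = copy-walk i a b
  ... | no  _    = subst (Walk X (enc (i , a)) (enc (j , b))) (sym (+-assoc (depth a) (dG i j) (depth b)))
                     (walk-++ (climb i a) (walk-++ (root-walk (d-walk i j)) (walk-reverse (climb j b))))

  δ-dist : ∀ p q → Dist X (enc p) (enc q) (δ p q)
  δ-dist p q = walk-upper p q , λ m m<δ w →
    <⇒≱ m<δ (subst₂ (λ p q → δ p q ≤ m) (dec-enc p) (dec-enc q) (walk-lower w))

  Between : P → P → P → Set
  Between w q p = δ w p ≡ δ w q + δ q p

  Resolves : P → P → P → Set
  Resolves w p q = Between w q p ⊎ Between w p q

  strongly-resolves⇒ : ∀ w p q → StronglyResolves X (enc w) (enc p) (enc q) → Resolves w p q
  strongly-resolves⇒ w p q (inj₁ (_ , _ , _ , wp , wq , qp , eq)) =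
    inj₁ (trans (dist-unique (δ-dist w p) wp)
                (trans eq (cong₂ _+_ (dist-unique wq (δ-dist w q)) (dist-unique qp (δ-dist q p)))))
  strongly-resolves⇒ w p q (inj₂ (_ , _ , _ , wq , wp , pq , eq)) =
    inj₂ (trans (dist-unique (δ-dist w q) wq)
                (trans eq (cong₂ _+_ (dist-unique wp (δ-dist w p)) (dist-unique pq (δ-dist p q)))))

  ⇒strongly-resolves : ∀ w p q → Resolves w p q → StronglyResolves X (enc w) (enc p) (enc q)
  ⇒strongly-resolves w p q (inj₁ eq) = inj₁ (_ , _ , _ , δ-dist w p , δ-dist w q , δ-dist q p , eq)
  ⇒strongly-resolves w p q (inj₂ eq) = inj₂ (_ , _ , _ , δ-dist w q , δ-dist w p , δ-dist p q , eq)

  self-resolves : ∀ p q → Resolves p p q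
  self-resolves p q = inj₂ (sym (cong (_+ δ p q) (δ-refl p)))

  Generator : Subset (r * t) → Set
  Generator S = ∀ p q → p ≢ q → ∃ λ w → enc w ∈ S × Resolves w p q

  generator⇒ : ∀ {S} → StrongMetricGenerator X S → Generator S
  generator⇒ {S} gen p q p≢q with gen (enc p) (enc q) (p≢q ∘ enc-injective)
  ... | x , x∈S , res = dec x , subst (_∈ S) (sym (enc-dec x)) x∈S ,
    strongly-resolves⇒ (dec x) p q (subst (λ y → StronglyResolves X y (enc p) (enc q)) (sym (enc-dec x)) res)

  ⇒generator : ∀ {S} → Generator S → StrongMetricGenerator X S
  ⇒generator gen x y x≢y with gen (dec x) (dec y) (λ e → x≢y (trans (sym (enc-dec x)) (trans (cong enc e) (enc-dec y))))
  ... | w , w∈S , res =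
    enc w , w∈S , subst₂ (StronglyResolves X (enc w)) (enc-dec x) (enc-dec y) (⇒strongly-resolves w (dec x) (dec y) res)

  ResolvedOnlyByEnds : P → P → Set
  ResolvedOnlyByEnds p q = ∀ w → Resolves w p q → w ≡ p ⊎ w ≡ q

  only-ends : ∀ {p q} → (∀ w → Between w q p → w ≡ q) → (∀ w → Between w p q → w ≡ p) →
              ResolvedOnlyByEnds p q
  only-ends q-end p-end w (inj₁ between) = inj₂ (q-end w between)
  only-ends q-end p-end w (inj₂ between) = inj₁ (p-end w between)

  end-in-generator : ∀ {S p q} → Generator S → p ≢ q → ResolvedOnlyByEnds p q → enc p ∈ S ⊎ enc q ∈ S
  end-in-generator gen p≢q only with gen _ _ p≢q
  ... | w , w∈S , res with only w res
  ...   | inj₁ refl = inj₁ w∈S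
  ...   | inj₂ refl = inj₂ w∈S

  distinct-copies-between : ∀ {i j a b} → i ≢ j → a ≢ v → b ≢ v →
                            ∀ w → Between w (j , b) (i , a) → w ≡ (j , b)
  distinct-copies-between {i} {j} {a} {b} i≢j a≢v b≢v (k , e) between
    rewrite δ-diff b a (i≢j ∘ sym) | depth-leaf a≢v | depth-leaf b≢v = from (k ≟ i) (k ≟ j)
    where
    from : Dec (k ≡ i) → Dec (k ≡ j) → (k , e) ≡ (j , b)
    from (yes refl) _ rewrite δ-same k e a =
      contradiction between (m≤2⇒m≢n+[1+o+1] (dH≤2 e a) (d-pos (i≢j ∘ sym)))
    from (no k≢i) (yes refl) rewrite δ-diff e a k≢i | δ-same k e b | depth-leaf a≢v =
      cong (k ,_) (dH≡0⇒≡ (n≤0⇒n≡0 (≤-pred (subst (_≤ 1) (m+o+1≡n+[1+o+1]⇒m≡1+n between) (depth≤1 e)))))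
    from (no k≢i) (no k≢j) rewrite δ-diff e a k≢i | δ-diff e b k≢j | depth-leaf a≢v | depth-leaf b≢v =
      contradiction between (<⇒≢ detour-longer)
      where
      x = depth e
      detour-longer : x + dG k i + 1 < (x + dG k j + 1) + (1 + dG j i + 1)
      detour-longer = begin-strict
        x + dG k i + 1                  ≤⟨ +-monoˡ-≤ 1 (+-monoʳ-≤ x (d-triangle k j i)) ⟩
        x + (dG k j + dG j i) + 1       ≡⟨ cong (_+ 1) (sym (+-assoc x (dG k j) (dG j i))) ⟩
        x + dG k j + dG j i + 1         <⟨ +-monoʳ-< (x + dG k j + dG j i) (s≤s (s≤s z≤n)) ⟩
        x + dG k j + dG j i + 3         ≡⟨ rearrange (x + dG k j) (dG j i) ⟩
        (x + dG k j + 1) + (1 + dG j i + 1) ∎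
        where
        open ≤-Reasoning
        rearrange : ∀ y B → y + B + 3 ≡ (y + 1) + (1 + B + 1)
        rearrange = solve-∀

  nonadjacent-between : ∀ {i a b} → b ≢ a → adj H b a ≡ false → a ≢ v → b ≢ v →
                        ∀ w → Between w (i , b) (i , a) → w ≡ (i , b)
  nonadjacent-between {i} {a} {b} b≢a b≁a a≢v b≢v (k , e) between
    rewrite δ-same i b a | dH-nonadj b≢a b≁a with k ≟ i
  ... | yes refl = cong (k ,_) (dH≡0⇒≡ (n≤0⇒n≡0 (+-cancelʳ-≤ 2 _ 0 (subst (_≤ 2) between (dH≤2 e a)))))
  ... | no k≢i rewrite depth-leaf a≢v | depth-leaf b≢v = contradiction between m≢m+1+n

  twin-between : ∀ {i a b} → Adj H b a → (∀ z → z ≢ a → z ≢ b → adj H z a ≡ adj H z b) →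
                 a ≢ v → b ≢ v →
                 ∀ w → Between w (i , b) (i , a) → w ≡ (i , b)
  twin-between {i} {a} {b} b~a twins a≢v b≢v (k , e) between
    rewrite δ-same i b a | dH-adj b~a with k ≟ i
  ... | no _ rewrite depth-leaf a≢v | depth-leaf b≢v = contradiction between m≢m+1+n
  ... | yes refl = cong (k ,_) (same-copy (e ≟ b) (e ≟ a))
    where
    same-copy : Dec (e ≡ b) → Dec (e ≡ a) → e ≡ b
    same-copy (yes e≡b) _        = e≡b
    same-copy (no _)    (yes refl) =
      contradiction (trans (sym between) (dH-refl e)) (m<n⇒n≢0 (m<m+n _ (s≤s z≤n)))
    same-copy (no e≢b)  (no e≢a) =
      contradiction (trans (sym (dH-twins e≢a e≢b (twins e e≢a e≢b))) between) m≢m+1+n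

  distinct-copies-resolved-only-by-ends : ∀ {i j a b} → i ≢ j → a ≢ v → b ≢ v → ResolvedOnlyByEnds (i , a) (j , b)
  distinct-copies-resolved-only-by-ends i≢j a≢v b≢v =
    only-ends (distinct-copies-between i≢j a≢v b≢v) (distinct-copies-between (i≢j ∘ sym) b≢v a≢v)

  nonadjacent-resolved-only-by-ends : ∀ {i a b} → a ≢ b → adj H a b ≡ false → a ≢ v → b ≢ v →
                                      ResolvedOnlyByEnds (i , a) (i , b)
  nonadjacent-resolved-only-by-ends {a = a} {b} a≢b a≁b a≢v b≢v =
    only-ends (nonadjacent-between (a≢b ∘ sym) (trans (sym' H b a) a≁b) a≢v b≢v)
              (nonadjacent-between a≢b a≁b b≢v a≢v)

  twins-resolved-only-by-ends : ∀ {i a b} → Adj H a b → (∀ z → z ≢ a → z ≢ b → adj H z a ≡ adj H z b) →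
                                a ≢ v → b ≢ v → ResolvedOnlyByEnds (i , a) (i , b)
  twins-resolved-only-by-ends a~b twins a≢v b≢v =
    only-ends (twin-between (Adj-sym H a~b) twins a≢v b≢v)
              (twin-between a~b (λ z z≢b z≢a → sym (twins z z≢a z≢b)) b≢v a≢v)

  root-on-exit : ∀ {i j} a b → i ≢ j → Between (i , a) (i , v) (j , b)
  root-on-exit {i} {j} a b i≢j rewrite δ-diff a b i≢j | δ-same i a v | δ-diff v b i≢j | depth-root | dH-to-root a =
    +-assoc (depth a) (dG i j) (depth b)

  root-on-entry : ∀ {i j} e b → j ≢ i → Between (j , e) (i , v) (i , b)
  root-on-entry {i} {j} e b j≢i rewrite δ-diff e b j≢i | δ-diff e v j≢i | δ-same i v b | depth-root | dH-root b =
    cong (_+ depth b) (sym (+-identityʳ _))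

  path-between : ∀ {i y a b} → Adj H y a → Adj H a b → y ≢ b → adj H y b ≡ false → Between (i , y) (i , a) (i , b)
  path-between {i} {y} {a} {b} y~a a~b y≢b y≁b
    rewrite δ-same i y b | δ-same i y a | δ-same i a b | dH-adj y~a | dH-adj a~b = dH-nonadj y≢b y≁b

  F : Graph t'
  F = deleteVertex H v

  leaf : Fin t' → Fin t
  leaf = punchIn v

  leaf≢v : ∀ z → leaf z ≢ v
  leaf≢v = punchInᵢ≢i v

  leaf-injective : ∀ {z z′} → leaf z ≡ leaf z′ → z ≡ z′
  leaf-injective = punchIn-injective v _ _

  data Kind (i₀ : Fin r) : P → Set where
    root       : ∀ k → Kind i₀ (k , v)
    leaf₀      : ∀ z → Kind i₀ (i₀ , leaf z)
    other-leaf : ∀ {k} z → k ≢ i₀ → Kind i₀ (k , leaf z)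

  leaf-of-nonroot : ∀ {e} → e ≢ v → ∃ λ z → leaf z ≡ e
  leaf-of-nonroot e≢v = punchOut (e≢v ∘ sym) , punchIn-punchOut (e≢v ∘ sym)

  kind : ∀ i₀ p → Kind i₀ p
  kind i₀ (k , e) with e ≟ v
  ... | yes refl = root k
  ... | no e≢v with leaf-of-nonroot e≢v | k ≟ i₀
  ...   | z , refl | yes refl = leaf₀ z
  ...   | z , refl | no k≢i₀  = other-leaf z k≢i₀

  inBasis : Subset t' → Fin r → P → Bool
  inBasis C i₀ (k , e) with v ≟ e
  ... | yes _   = false
  ... | no v≢e = not (eqb k i₀ ∧ lookup C (punchOut v≢e))

  inBasis-root : ∀ C i₀ k → inBasis C i₀ (k , v) ≡ false
  inBasis-root C i₀ k with v ≟ v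
  ... | yes _   = refl
  ... | no v≢v = contradiction refl v≢v

  inBasis-leaf : ∀ C i₀ k z → inBasis C i₀ (k , leaf z) ≡ not (eqb k i₀ ∧ lookup C z)
  inBasis-leaf C i₀ k z with v ≟ leaf z
  ... | yes v≡leaf = contradiction (sym v≡leaf) (leaf≢v z)
  ... | no v≢leaf = cong (λ z′ → not (eqb k i₀ ∧ lookup C z′)) (trans (punchOut-cong v refl) (punchOut-punchIn v))

  basis : Subset t' → Fin r → Subset (r * t)
  basis C i₀ = tabulate (inBasis C i₀ ∘ dec)

  ∈basis⇒ : ∀ {C i₀} p → enc p ∈ basis C i₀ → inBasis C i₀ p ≡ true
  ∈basis⇒ {C} {i₀} p p∈ =
    trans (sym (cong (inBasis C i₀) (dec-enc p))) (trans (sym (lookup∘tabulate _ (enc p))) ([]=⇒lookup p∈))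

  ⇒∈basis : ∀ {C i₀} p → inBasis C i₀ p ≡ true → enc p ∈ basis C i₀
  ⇒∈basis {C} {i₀} p e =
    lookup⇒[]= (enc p) _ (trans (lookup∘tabulate _ (enc p)) (trans (cong (inBasis C i₀) (dec-enc p)) e))

  ∣basis∣+∣C∣ : ∀ C i₀ → ∣ basis C i₀ ∣ + ∣ C ∣ ≡ r * t'
  ∣basis∣+∣C∣ C i₀ = begin
    ∣ basis C i₀ ∣ + ∣ C ∣                        ≡⟨ cong (_+ ∣ C ∣) (∣tabulate∣≡count (inBasis C i₀ ∘ dec)) ⟩
    count (inBasis C i₀ ∘ remQuot t) + ∣ C ∣     ≡⟨ cong (_+ ∣ C ∣) (count-remQuot r t (inBasis C i₀)) ⟩
    ∑ r row + ∣ C ∣                              ≡⟨ ∑-deficient-row r t' row i₀ ∣ C ∣ row-i₀ row-other ⟩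
    r * t'                                       ∎
    where
    open ≡-Reasoning
    row : Fin r → ℕ
    row k = count (λ e → inBasis C i₀ (k , e))
    row-leaves : ∀ k → row k ≡ count (λ z → not (eqb k i₀ ∧ lookup C z))
    row-leaves k = trans (count-punchIn v (λ e → inBasis C i₀ (k , e)) (inBasis-root C i₀ k))
                         (count-cong (inBasis-leaf C i₀ k))
    row-i₀ : row i₀ + ∣ C ∣ ≡ t'
    row-i₀ rewrite row-leaves i₀ | eqb-refl i₀ | ∣p∣≡count C =
      trans (+-comm _ (count (lookup C))) (count+count-not t' (lookup C))
    row-other : ∀ k → k ≢ i₀ → row k ≡ t'
    row-other k k≢i₀ rewrite row-leaves k | ≢⇒eqb≡false k≢i₀ = count-true t'

  ∣basis∣ : ∀ C i₀ → ∣ basis C i₀ ∣ ≡ r * t' ∸ ∣ C ∣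
  ∣basis∣ C i₀ = trans (sym (m+n∸n≡m _ ∣ C ∣)) (cong (_∸ ∣ C ∣) (∣basis∣+∣C∣ C i₀))

  twins-of-deleteVertex : ∀ {z₁ z₂} → TrueTwins F z₁ z₂ →
                          ∀ y → y ≢ leaf z₁ → y ≢ leaf z₂ → adj H y (leaf z₁) ≡ adj H y (leaf z₂)
  twins-of-deleteVertex {z₁} {z₂} twins y y≢z₁ y≢z₂ with y ≟ v
  ... | yes refl = trans (universal _ (leaf≢v z₁)) (sym (universal _ (leaf≢v z₂)))
  ... | no y≢v with leaf-of-nonroot y≢v
  ...   | y′ , refl = trans (sym' H _ _) (trans (Bool-ext to from) (sym' H _ _))
    where
    to : Adj F z₁ y′ → Adj F z₂ y′
    to z₁~y′ with proj₁ (twins y′) (inj₂ z₁~y′)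
    ... | inj₁ refl  = contradiction refl y≢z₂
    ... | inj₂ z₂~y′ = z₂~y′
    from : Adj F z₂ y′ → Adj F z₁ y′
    from z₂~y′ with proj₂ (twins y′) (inj₂ z₂~y′)
    ... | inj₁ refl  = contradiction refl y≢z₁
    ... | inj₂ z₁~y′ = z₁~y′

  module LowerBound {S : Subset (r * t)} (gen : Generator S) where

    missing-leaves-share-copy : ∀ {k k′ z z′} → enc (k , leaf z) ∉ S → enc (k′ , leaf z′) ∉ S → k ≡ k′
    missing-leaves-share-copy {k} {k′} {z} {z′} ∉S ∉S′ with k ≟ k′
    ... | yes k≡k′ = k≡k′
    ... | no k≢k′  = ⊥-elim ([ ∉S , ∉S′ ]′ (end-in-generator gen (k≢k′ ∘ cong proj₁)
                       (distinct-copies-resolved-only-by-ends k≢k′ (leaf≢v z) (leaf≢v z′))))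

    copy-containing-missing-leaves : Fin r → Σ (Fin r) λ i₀ → ∀ k z → k ≢ i₀ → enc (k , leaf z) ∈ S
    copy-containing-missing-leaves i with any? (λ k → any? (λ z → ¬? (enc (k , leaf z) ∈? S)))
    ... | yes (k₀ , z₀ , ∉S₀) = k₀ , λ k z k≢k₀ →
      decidable-stable (enc (k , leaf z) ∈? S) (λ ∉S → k≢k₀ (missing-leaves-share-copy ∉S ∉S₀))
    ... | no none = i , λ k z _ → decidable-stable (enc (k , leaf z) ∈? S) (λ ∉S → none (k , z , ∉S))

    module _ (i₀ : Fin r) where

      missing : Subset t'
      missing = tabulate λ z → not ⌊ enc (i₀ , leaf z) ∈? S ⌋

      missing-spec : ∀ z → lookup missing z ≡ not ⌊ enc (i₀ , leaf z) ∈? S ⌋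
      missing-spec = lookup∘tabulate _

      ∈missing⇒∉S : ∀ {z} → z ∈ missing → enc (i₀ , leaf z) ∉ S
      ∈missing⇒∉S {z} z∈ ∈S with enc (i₀ , leaf z) ∈? S | trans (sym (missing-spec z)) ([]=⇒lookup z∈)
      ... | no ∉S | _ = ∉S ∈S

      ∉missing⇒∈S : ∀ {z} → lookup missing z ≡ false → enc (i₀ , leaf z) ∈ S
      ∉missing⇒∈S {z} z∉ with enc (i₀ , leaf z) ∈? S | trans (sym (missing-spec z)) z∉
      ... | yes ∈S | _ = ∈S

      neither-in-S : ∀ {z₁ z₂} → z₁ ∈ missing → z₂ ∈ missing →
                     ¬ (enc (i₀ , leaf z₁) ∈ S ⊎ enc (i₀ , leaf z₂) ∈ S)
      neither-in-S z₁∈ z₂∈ = [ ∈missing⇒∉S z₁∈ , ∈missing⇒∉S z₂∈ ]′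

      leaves-differ : ∀ {z₁ z₂} → z₁ ≢ z₂ → (i₀ , leaf z₁) ≢ (i₀ , leaf z₂)
      leaves-differ z₁≢z₂ e = z₁≢z₂ (leaf-injective (cong proj₂ e))

      missing-clique : ∀ z₁ z₂ → z₁ ∈ missing → z₂ ∈ missing → z₁ ≢ z₂ → Adj F z₁ z₂
      missing-clique z₁ z₂ z₁∈ z₂∈ z₁≢z₂ with adj F z₁ z₂ in e
      ... | true  = refl
      ... | false = ⊥-elim (neither-in-S z₁∈ z₂∈ (end-in-generator gen (leaves-differ z₁≢z₂)
                      (nonadjacent-resolved-only-by-ends (z₁≢z₂ ∘ leaf-injective) e (leaf≢v z₁) (leaf≢v z₂))))

      missing-twin-free : ∀ z₁ z₂ → z₁ ∈ missing → z₂ ∈ missing → z₁ ≢ z₂ → ¬ TrueTwins F z₁ z₂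
      missing-twin-free z₁ z₂ z₁∈ z₂∈ z₁≢z₂ twins =
        neither-in-S z₁∈ z₂∈ (end-in-generator gen (leaves-differ z₁≢z₂)
          (twins-resolved-only-by-ends (missing-clique z₁ z₂ z₁∈ z₂∈ z₁≢z₂) (twins-of-deleteVertex twins)
                                       (leaf≢v z₁) (leaf≢v z₂)))

      missing-twinFreeClique : TwinFreeClique F missing
      missing-twinFreeClique = missing-clique , missing-twin-free

      basis⊆S : (∀ k z → k ≢ i₀ → enc (k , leaf z) ∈ S) → basis missing i₀ ⊆ S
      basis⊆S others-in {x} x∈ =
        subst (_∈ S) (enc-dec x) (in-S (dec x) (kind i₀ (dec x)) (∈basis⇒ (dec x) (subst (_∈ _) (sym (enc-dec x)) x∈)))
        where
        in-S : ∀ p → Kind i₀ p → inBasis missing i₀ p ≡ true → enc p ∈ S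
        in-S _ (root k) b rewrite inBasis-root missing i₀ k = contradiction b λ ()
        in-S _ (other-leaf z k≢i₀) _ = others-in _ z k≢i₀
        in-S _ (leaf₀ z) b rewrite inBasis-leaf missing i₀ i₀ z | eqb-refl i₀ with lookup missing z in z∉
        ... | false = ∉missing⇒∈S z∉

  module UpperBound (C : Subset t') (C-tfc : TwinFreeClique F C)
                    {i₀ j₀ : Fin r} (j₀≢i₀ : j₀ ≢ i₀) (z₀ : Fin t') where

    B : Subset (r * t)
    B = basis C i₀

    Resolved : P → P → Set
    Resolved p q = ∃ λ w → enc w ∈ B × Resolves w p q

    resolved-sym : ∀ {p q} → Resolved p q → Resolved q p
    resolved-sym (w , w∈B , res) = w , w∈B , swap res

    by-itself : ∀ {p} q → enc p ∈ B → Resolved p q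
    by-itself {p} q p∈B = p , p∈B , self-resolves p q

    other-leaf∈B : ∀ {k} z → k ≢ i₀ → enc (k , leaf z) ∈ B
    other-leaf∈B {k} z k≢i₀ =
      ⇒∈basis _ (trans (inBasis-leaf C i₀ k z) (cong (λ b → not (b ∧ lookup C z)) (≢⇒eqb≡false k≢i₀)))

    leaf₀∈B : ∀ {z} → lookup C z ≡ false → enc (i₀ , leaf z) ∈ B
    leaf₀∈B {z} z∉C =
      ⇒∈basis _ (trans (inBasis-leaf C i₀ i₀ z) (cong₂ (λ a b → not (a ∧ b)) (eqb-refl i₀) z∉C))

    roots : ∀ {k k′} → k ≢ k′ → Resolved (k , v) (k′ , v)
    roots {k} {k′} k≢k′ = by-cases (k ≟ i₀)
      where
      by-cases : Dec (k ≡ i₀) → Resolved (k , v) (k′ , v)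
      by-cases (no k≢i₀)  = (k , leaf z₀) , other-leaf∈B z₀ k≢i₀ , inj₂ (root-on-exit (leaf z₀) v k≢k′)
      by-cases (yes refl) =
        (k′ , leaf z₀) , other-leaf∈B z₀ (k≢k′ ∘ sym) , inj₁ (root-on-exit (leaf z₀) v (k≢k′ ∘ sym))

    root-and-leaf₀ : ∀ k z → Resolved (k , v) (i₀ , leaf z)
    root-and-leaf₀ k z = by-cases (k ≟ i₀)
      where
      by-cases : Dec (k ≡ i₀) → Resolved (k , v) (i₀ , leaf z)
      by-cases (no k≢i₀)  = (k , leaf z₀) , other-leaf∈B z₀ k≢i₀ , inj₂ (root-on-exit (leaf z₀) (leaf z) k≢i₀)
      by-cases (yes refl) =
        (j₀ , leaf z₀) , other-leaf∈B z₀ j₀≢i₀ , inj₂ (root-on-entry (leaf z₀) (leaf z) j₀≢i₀)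

    clique : ∀ {z₁ z₂} → lookup C z₁ ≡ true → lookup C z₂ ≡ true → z₁ ≢ z₂ → Adj F z₁ z₂
    clique {z₁} {z₂} z₁∈C z₂∈C = proj₁ C-tfc z₁ z₂ (lookup⇒[]= z₁ C z₁∈C) (lookup⇒[]= z₂ C z₂∈C)

    separated : ∀ {z₁ z₂ y} → lookup C z₁ ≡ true → lookup C z₂ ≡ true → z₁ ≢ z₂ →
                ClosedNbr F z₁ y → ¬ ClosedNbr F z₂ y → Resolved (i₀ , leaf z₁) (i₀ , leaf z₂)
    separated {z₁} {z₂} {y} z₁∈C z₂∈C z₁≢z₂ y∈N[z₁] y∉N[z₂] =
      (i₀ , leaf y) , leaf₀∈B y∉C ,
      inj₂ (path-between {i₀} (Adj-sym F z₁~y) (clique z₁∈C z₂∈C z₁≢z₂) y≢z₂ y≁z₂)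
      where
      z₁~y : Adj F z₁ y
      z₁~y = [ (λ { refl → contradiction (inj₂ (clique z₂∈C z₁∈C (z₁≢z₂ ∘ sym))) y∉N[z₂] }) , (λ z₁~y → z₁~y) ]′
               y∈N[z₁]
      y≢z₂ : leaf y ≢ leaf z₂
      y≢z₂ e = y∉N[z₂] (inj₁ (leaf-injective e))
      y≁z₂ : adj F y z₂ ≡ false
      y≁z₂ with adj F y z₂ in y~z₂
      ... | false = refl
      ... | true  = contradiction (inj₂ (Adj-sym F y~z₂)) y∉N[z₂]
      y∉C : lookup C y ≡ false
      y∉C with lookup C y in y∈C
      ... | false = refl
      ... | true  = contradiction (inj₂ (clique z₂∈C y∈C (y≢z₂ ∘ cong leaf ∘ sym))) y∉N[z₂]

    clique-leaves : ∀ {z₁ z₂} → lookup C z₁ ≡ true → lookup C z₂ ≡ true → z₁ ≢ z₂ →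
                    Resolved (i₀ , leaf z₁) (i₀ , leaf z₂)
    clique-leaves {z₁} {z₂} z₁∈C z₂∈C z₁≢z₂
      with distinguisher F (proj₂ C-tfc z₁ z₂ (lookup⇒[]= z₁ C z₁∈C) (lookup⇒[]= z₂ C z₂∈C) z₁≢z₂)
    ... | y , inj₁ (y∈N[z₁] , y∉N[z₂]) = separated z₁∈C z₂∈C z₁≢z₂ y∈N[z₁] y∉N[z₂]
    ... | y , inj₂ (y∈N[z₂] , y∉N[z₁]) =
      resolved-sym (separated z₂∈C z₁∈C (z₁≢z₂ ∘ sym) y∈N[z₂] y∉N[z₁])

    resolved : ∀ {p q} → Kind i₀ p → Kind i₀ q → p ≢ q → Resolved p q
    resolved (other-leaf z k≢i₀) _ _ = by-itself _ (other-leaf∈B z k≢i₀)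
    resolved _ (other-leaf z k≢i₀) _ = resolved-sym (by-itself _ (other-leaf∈B z k≢i₀))
    resolved (root k) (root k′) p≢q  = roots (p≢q ∘ cong (_, v))
    resolved (root k) (leaf₀ z) _    = root-and-leaf₀ k z
    resolved (leaf₀ z) (root k) _    = resolved-sym (root-and-leaf₀ k z)
    resolved (leaf₀ z₁) (leaf₀ z₂) p≢q with lookup C z₁ in e₁ | lookup C z₂ in e₂
    ... | false | _     = by-itself _ (leaf₀∈B e₁)
    ... | true  | false = resolved-sym (by-itself _ (leaf₀∈B e₂))
    ... | true  | true  = clique-leaves e₁ e₂ (p≢q ∘ cong (λ z → i₀ , leaf z))

    basis-generator : Generator B
    basis-generator p q = resolved (kind i₀ p) (kind i₀ q)

  strong-metric-dimension : ∀ {i₀ j₀ : Fin r} → j₀ ≢ i₀ → Fin t' →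
                            ∀ w → IsTwinFreeCliqueNumber F w → IsStrongMetricDim X (r * t' ∸ w)
  strong-metric-dimension {i₀} j₀≢i₀ z₀ w ((C , C-tfc , ∣C∣≡w) , maximum) =
    (basis C i₀ , ⇒generator basis-generator , trans (∣basis∣ C i₀) (cong (r * t' ∸_) ∣C∣≡w)) , lower-bound
    where
    open UpperBound C C-tfc j₀≢i₀ z₀
    lower-bound : ∀ S → StrongMetricGenerator X S → r * t' ∸ w ≤ ∣ S ∣
    lower-bound S gen = begin
      r * t' ∸ w               ≤⟨ ∸-monoʳ-≤ (r * t') (maximum _ (missing-twinFreeClique k₀)) ⟩
      r * t' ∸ ∣ missing k₀ ∣   ≡⟨ sym (∣basis∣ (missing k₀) k₀) ⟩
      ∣ basis (missing k₀) k₀ ∣ ≤⟨ p⊆q⇒∣p∣≤∣q∣ (basis⊆S k₀ others-in) ⟩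
      ∣ S ∣                    ∎
      where
      open ≤-Reasoning
      open LowerBound (generator⇒ gen)
      k₀ : Fin r
      k₀ = proj₁ (copy-containing-missing-leaves i₀)
      others-in : ∀ k z → k ≢ k₀ → enc (k , leaf z) ∈ S
      others-in = proj₂ (copy-containing-missing-leaves i₀)

corollary13 : (r t' : ℕ) (G : Graph r) (H : Graph (suc t')) (v : Fin (suc t'))
    → 2 ≤ r → Connected G
    → 2 ≤ suc t' → Connected H
    → degree H v ≡ t'
    → (w : ℕ) → IsTwinFreeCliqueNumber (deleteVertex H v) w
    → IsStrongMetricDim (rootedProduct G v H) (r * t' ∸ w)
corollary13 (suc (suc _)) (suc _) G H v (s≤s (s≤s _)) connected (s≤s (s≤s _)) _ deg =
  RootedProduct.strong-metric-dimension G H v connected (full-degree⇒universal H v deg)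
    {zero} {suc zero} (λ ()) zero
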